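{- Let $E$ be a finite list of linearly independent vectors in $\mathbb{Z}^n$, and let $\mathcal{M}=(E,r,m)$ with $r(A)=\operatorname{rank}\langle A\rangle$ and $m(A)=|(\mathbb{Z}^n/\langle A\rangle)_{\mathrm{tor}}|$ for $A\subseteq E$. For a family $\underline k=(k_e)_{e\in E}$ of positive integers and $A\subseteq E$, let $\underline k\cdot A=\{k_ee:e\in A\}$ and let $\mathcal{Z}(\underline k\cdot A)^\diamond=\{\sum_{e\in A}\lambda_ek_ee: 0\le\lambda_e<1\}$ be the half-open zonotope. For $p_e\in[0,1]$, $$\mathbb{E}\bigl[|\mathcal{Z}(\underline k\cdot E_{\underline p})^\diamond\cap\mathbb{Z}^n|\bigr]=\prod_{e\in E}(1-p_e)\;\mathbf{Z}_{\mathcal{M}}\Bigl(1,\bigl(\tfrac{k_ep_e}{1-p_e}\bigr)_{e\in E}\Bigr).$$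
   Context: $\langle A\rangle$ is the subgroup of $\mathbb{Z}^n$ generated by $A$ and $(\cdot)_{\mathrm{tor}}$ the torsion subgroup. $\mathbf{Z}_{\mathcal{M}}(q,(v_e))=\sum_{A\subseteq E}m(A)q^{ -r(A)}\prod_{e\in A}v_e$. $E_{\underline p}$ is the random sublist containing each $e$ independently with probability $p_e$. The right-hand side is understood as the polynomial $\sum_{A\subseteq E}m(A)\prod_{e\in A}k_ep_e\prod_{e\in E\setminus A}(1-p_e)$. -}

module Defs where

open import Level using (Level)
open import Data.Bool using (Bool; true; false; if_then_else_)
open import Data.Nat as ℕ using (ℕ; zero; suc)
open import Data.Integer as ℤ using (ℤ; +_)
open import Data.Rational as ℚ using (ℚ; 0ℚ; 1ℚ)
open import Data.Fin using (Fin; zero; suc)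
open import Data.Fin.Subset using (Subset; _∈_; _∉_)
open import Data.Vec using (Vec; lookup; []; _∷_)
open import Data.List using (List; length)
import Data.List.Membership.Propositional as LM
open import Data.List.Relation.Unary.Unique.Propositional using (Unique)
open import Data.List.Relation.Unary.All using (All)
open import Data.List.Relation.Unary.AllPairs using (AllPairs)
open import Data.List.Relation.Unary.Any using (Any)
open import Data.Product using (Σ; ∃; _×_; _,_)
open import Relation.Binary.PropositionalEquality using (_≡_)
open import Relation.Nullary using (¬_)
open import Function.Bundles using (_⇔_)
open import Algebra.Bundles using (CommutativeRing)

-- Integer points are vectors in ℤ^n; a list E of m vectors is a map Fin m → ℤ^n.
Point : ℕ → Set
Point n = Vec ℤ n

Σℤ : ∀ {m} → (Fin m → ℤ) → ℤ
Σℤ {zero}  f = + 0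
Σℤ {suc m} f = f zero ℤ.+ Σℤ (λ i → f (suc i))

Σℚ : ∀ {m} → (Fin m → ℚ) → ℚ
Σℚ {zero}  f = 0ℚ
Σℚ {suc m} f = f zero ℚ.+ Σℚ (λ i → f (suc i))

-- E linearly independent (integer coefficients; equivalent to over ℝ for integer vectors)
LinIndep : ∀ {m n} → (Fin m → Point n) → Set
LinIndep {m} {n} E =
  (c : Fin m → ℤ) → (∀ (i : Fin n) → Σℤ (λ e → c e ℤ.* lookup (E e) i) ≡ + 0) →
  ∀ e → c e ≡ + 0

InSpan : ∀ {m n} → (Fin m → Point n) → Subset m → Point n → Set
InSpan {m} {n} E A y =
  ∃ λ (c : Fin m → ℤ) → ∀ (i : Fin n) →
    lookup y i ≡ Σℤ (λ e → if lookup A e then c e ℤ.* lookup (E e) i else + 0)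

Torsion : ∀ {m n} → (Fin m → Point n) → Subset m → Point n → Set
Torsion {n = n} E A x = ∃ λ (d : ℕ) →
  InSpan E A (Data.Vec.map (λ t → + (suc d) ℤ.* t) x)

CongMod : ∀ {m n} → (Fin m → Point n) → Subset m → Point n → Point n → Set
CongMod E A x x' = InSpan E A (Data.Vec.zipWith ℤ._-_ x x')

-- |(ℤ^n/⟨A⟩)_tor| = N : there are N pairwise incongruent torsion representatives,
-- and every torsion class is represented.
TorsionCard : ∀ {m n} → (Fin m → Point n) → Subset m → ℕ → Set
TorsionCard {n = n} E A N = ∃ λ (ts : List (Point n)) →
  length ts ≡ N ×
  All (Torsion E A) ts ×
  AllPairs (λ a b → ¬ CongMod E A a b) ts ×
  (∀ (x : Point n) → Torsion E A x → Any (CongMod E A x) ts)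

InZonotope : ∀ {m n} → (Fin m → Point n) → (Fin m → ℕ) → Subset m → Point n → Set
InZonotope {m} {n} E k A x =
  ∃ λ (lam : Fin m → ℚ) →
    (∀ e → e ∈ A → (0ℚ ℚ.≤ lam e) × (lam e ℚ.< 1ℚ)) ×
    (∀ (i : Fin n) → lookup x i ℚ./ 1 ≡
       Σℚ (λ e → if lookup A e
                   then lam e ℚ.* ((+ k e ℤ.* lookup (E e) i) ℚ./ 1)
                   else 0ℚ))

ZonoCard : ∀ {m n} → (Fin m → Point n) → (Fin m → ℕ) → Subset m → ℕ → Set
ZonoCard {n = n} E k A N = ∃ λ (xs : List (Point n)) →
  length xs ≡ N × Unique xs × (∀ (x : Point n) → (x LM.∈ xs) ⇔ InZonotope E k A x)

module RingOps {c ℓ : Level} (R : CommutativeRing c ℓ) where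
  open CommutativeRing R hiding (zero)

  fromℕ : ℕ → Carrier
  fromℕ zero    = 0#
  fromℕ (suc n) = 1# + fromℕ n

  ΣSub : ∀ {m} → (Subset m → Carrier) → Carrier
  ΣSub {zero}  f = f []
  ΣSub {suc m} f = ΣSub (λ A → f (true ∷ A)) + ΣSub (λ A → f (false ∷ A))

  ΠFin : ∀ {m} → (Fin m → Carrier) → Carrier
  ΠFin {zero}  f = 1#
  ΠFin {suc m} f = f zero * ΠFin (λ i → f (suc i))

  Prob : ∀ {m} → (Fin m → Carrier) → Subset m → Carrier
  Prob p A = ΠFin (λ e → if lookup A e then p e else (1# - p e))

  Expect : ∀ {m} → (Fin m → Carrier) → (Subset m → ℕ) → Carrier
  Expect p X = ΣSub (λ A → Prob p A * fromℕ (X A))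

  -- ∏(1-p_e) · Z_M(1, (k_e p_e/(1-p_e))), read as the polynomial
  -- Σ_A m(A) ∏_{e∈A} k_e p_e ∏_{e∉A} (1-p_e)   (q = 1, so q^{-r(A)} = 1)
  RHS : ∀ {m} → (Fin m → ℕ) → (Fin m → Carrier) → (Subset m → ℕ) → Carrier
  RHS k p mult = ΣSub (λ A → fromℕ (mult A) *
    ΠFin (λ e → if lookup A e then fromℕ (k e) * p e else (1# - p e)))

module Submission where

-- Idea.  For each A ⊆ E the integer points of the half-open parallelepiped
-- Π(A)^◇ = {Σ_{e∈A} λ_e E_e : 0 ≤ λ_e < 1} form a system of representatives of (ℤ^n/⟨A⟩)_tor, so
-- there are m(A) of them; and 𝒵(k·A)^◇ is tiled by the translates of Π(A)^◇ by Σ_{e∈A} j_e E_e,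
-- 0 ≤ j_e < k_e, so it has ∏_{e∈A} k_e · m(A) integer points.  The identity then holds termwise.
--
-- Linear independence makes coefficients unique (comb-injective),
-- giving uniqueness of representatives (para-unique); division with remainder on the coefficients
-- gives existence (reduce).  To list Π(A)^◇ ∩ ℤ^n we bound it in a finite box and show by
-- pigeonhole that all its points can be written over one fixed denominator, which makes
-- membership decidable.

open import Defs
open import Level using (Level)
open import Algebra.Bundles using (CommutativeRing)
import Algebra.Properties.Semiring.Mult as SemiringMult
open import Data.Bool using (true; false; if_then_else_)
open import Data.Nat as ℕ using (ℕ; zero; suc; _<_; _≤_; z≤n; _∸_; _!)
import Data.Nat.Properties as ℕP
import Data.Nat.DivMod as ℕDM
open import Data.Nat.Divisibility using (_∣_; divides; ∣-trans; m≤n⇒m!∣n!; quotient; quotient≢0; m∣n⇒n≡quotient*m; n∣m*n; m∣m*n)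
open import Data.Integer as ℤ using (ℤ; +_; -[1+_]; _+_; _*_; _-_; -_; ∣_∣; _⊖_)
import Data.Integer.Properties as ℤP
import Data.Integer.DivMod as ℤDM
open import Data.Integer.Tactic.RingSolver using (solve-∀)
open import Data.Rational as ℚ using (ℚ; 0ℚ; 1ℚ; mkℚ)
import Data.Rational.Properties as ℚP
open import Data.Rational.Unnormalised as ℚᵘ using (mkℚᵘ; *≡*)
import Data.Rational.Unnormalised.Properties as ℚᵘP
open import Data.Fin using (Fin; zero; suc; toℕ)
import Data.Fin.Properties as FinP
open import Data.Fin.Subset using (Subset) renaming (_∈_ to _∈ₛ_)
open import Data.Vec using (Vec; lookup; tabulate; zipWith; []; _∷_)
import Data.Vec.Properties as VecP
open import Data.List using (List; []; _∷_; length; map; upTo; filter; _++_; cartesianProductWith; cartesianProduct)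
import Data.List.Properties as ListP
open import Data.List.Membership.Propositional using (_∈_; find)
import Data.List.Membership.Propositional.Properties as ∈P
open import Data.List.Relation.Unary.Any as Any using (Any; here; there)
import Data.List.Relation.Unary.Any.Properties as AnyP
open import Data.List.Relation.Unary.All as All using ([])
import Data.List.Relation.Unary.All.Properties as AllP
open import Data.List.Relation.Unary.AllPairs using (AllPairs; []; _∷_)
open import Data.List.Relation.Unary.Unique.Propositional using (Unique)
import Data.List.Relation.Unary.Unique.Propositional.Properties as UniqueP
open import Data.Product using (∃; ∃₂; _×_; _,_; proj₁; proj₂)
open import Function.Bundles using (mk⇔)
open import Relation.Nullary using (¬_; Dec)
open import Relation.Binary.PropositionalEquality using (_≡_; refl; sym; trans; cong; cong₂; subst; subst₂; module ≡-Reasoning)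

private variable
  m n : ℕ
  X Y Z : Set

vec-ext : ∀ {A : Set} {n} (u v : Vec A n) → (∀ i → lookup u i ≡ lookup v i) → u ≡ v
vec-ext u v h = trans (sym (VecP.tabulate∘lookup u)) (trans (VecP.tabulate-cong h) (VecP.tabulate∘lookup v))

Σℤ-cong : {f g : Fin m → ℤ} → (∀ e → f e ≡ g e) → Σℤ f ≡ Σℤ g
Σℤ-cong {zero}  h = refl
Σℤ-cong {suc m} h = cong₂ _+_ (h zero) (Σℤ-cong (λ e → h (suc e)))

Σℤ-+ : (f g : Fin m → ℤ) → Σℤ (λ e → f e + g e) ≡ Σℤ f + Σℤ g
Σℤ-+ {zero}  f g = refl
Σℤ-+ {suc m} f g = begin
  (f zero + g zero) + Σℤ (λ e → f (suc e) + g (suc e))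
    ≡⟨ cong (_+_ (f zero + g zero)) (Σℤ-+ (λ e → f (suc e)) (λ e → g (suc e))) ⟩
  (f zero + g zero) + (Σℤ (λ e → f (suc e)) + Σℤ (λ e → g (suc e)))
    ≡⟨ interchange (f zero) (g zero) _ _ ⟩
  (f zero + Σℤ (λ e → f (suc e))) + (g zero + Σℤ (λ e → g (suc e))) ∎
  where
  open ≡-Reasoning
  interchange : ∀ a b c d → (a + b) + (c + d) ≡ (a + c) + (b + d)
  interchange = solve-∀

Σℤ-* : (a : ℤ) (f : Fin m → ℤ) → Σℤ (λ e → a * f e) ≡ a * Σℤ f
Σℤ-* {zero}  a f = sym (ℤP.*-zeroʳ a)
Σℤ-* {suc m} a f = trans (cong (_+_ (a * f zero)) (Σℤ-* a (λ e → f (suc e))))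
                         (sym (ℤP.*-distribˡ-+ a (f zero) _))

Σℤ-zero : ∀ m → Σℤ {m} (λ _ → + 0) ≡ + 0
Σℤ-zero zero    = refl
Σℤ-zero (suc m) = trans (ℤP.+-identityˡ _) (Σℤ-zero m)

comb : (E : Fin m → Point n) (A : Subset m) (c : Fin m → ℤ) (i : Fin n) → ℤ
comb E A c i = Σℤ (λ e → if lookup A e then c e * lookup (E e) i else + 0)

module _ (E : Fin m → Point n) (A : Subset m) where

  comb-cong : (c c' : Fin m → ℤ) → (∀ e → lookup A e ≡ true → c e ≡ c' e) →
              ∀ i → comb E A c i ≡ comb E A c' i
  comb-cong c c' h i = Σℤ-cong (λ e → term e (lookup A e) refl)
    where
    term : ∀ e b → lookup A e ≡ b →
           (if b then c e * lookup (E e) i else + 0) ≡ (if b then c' e * lookup (E e) i else + 0)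
    term e true  inA = cong (_* lookup (E e) i) (h e inA)
    term e false _   = refl

  comb-+ : (c c' : Fin m → ℤ) → ∀ i → comb E A (λ e → c e + c' e) i ≡ comb E A c i + comb E A c' i
  comb-+ c c' i = trans (Σℤ-cong (λ e → term e (lookup A e))) (Σℤ-+ {m} _ _)
    where
    term : ∀ e b → (if b then (c e + c' e) * lookup (E e) i else + 0) ≡
                   (if b then c e * lookup (E e) i else + 0) + (if b then c' e * lookup (E e) i else + 0)
    term e true  = ℤP.*-distribʳ-+ (lookup (E e) i) (c e) (c' e)
    term e false = refl

  comb-* : (a : ℤ) (c : Fin m → ℤ) → ∀ i → comb E A (λ e → a * c e) i ≡ a * comb E A c i
  comb-* a c i = trans (Σℤ-cong (λ e → term e (lookup A e))) (Σℤ-* {m} a _)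
    where
    term : ∀ e b → (if b then (a * c e) * lookup (E e) i else + 0) ≡
                   a * (if b then c e * lookup (E e) i else + 0)
    term e true  = ℤP.*-assoc a (c e) _
    term e false = sym (ℤP.*-zeroʳ a)

  comb-- : (c c' : Fin m → ℤ) → ∀ i → comb E A (λ e → c e - c' e) i ≡ comb E A c i - comb E A c' i
  comb-- c c' i = begin
    comb E A (λ e → c e - c' e) i                ≡⟨ comb-+ c (λ e → - c' e) i ⟩
    comb E A c i + comb E A (λ e → - c' e) i     ≡⟨ cong (_+_ (comb E A c i)) negate ⟩
    comb E A c i - comb E A c' i                 ∎
    where
    open ≡-Reasoning
    neg≡-1* : ∀ x → - x ≡ -[1+ 0 ] * x
    neg≡-1* = solve-∀
    negate : comb E A (λ e → - c' e) i ≡ - comb E A c' i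
    negate = trans (comb-cong _ _ (λ e _ → neg≡-1* (c' e)) i)
                   (trans (comb-* -[1+ 0 ] c' i) (sym (neg≡-1* _)))

  comb-zero : (c : Fin m → ℤ) → (∀ e → lookup A e ≡ true → c e ≡ + 0) → ∀ i → comb E A c i ≡ + 0
  comb-zero c h i = trans (comb-cong c (λ _ → + 0) h i)
                          (trans (Σℤ-cong (λ e → term (lookup A e))) (Σℤ-zero m))
    where
    term : ∀ b → (if b then + 0 else + 0) ≡ + 0
    term true  = refl
    term false = refl

  comb-injective : LinIndep E → (c c' : Fin m → ℤ) → (∀ i → comb E A c i ≡ comb E A c' i) →
                   ∀ e → lookup A e ≡ true → c e ≡ c' e
  comb-injective indep c c' same e inA =
    ℤP.i-j≡0⇒i≡j _ _ (trans (sym (restrict inA)) (indep δ δ-relation e))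
    where
    δ : Fin m → ℤ
    δ e = if lookup A e then c e - c' e else + 0
    restrict : ∀ {e} → lookup A e ≡ true → δ e ≡ c e - c' e
    restrict inA rewrite inA = refl
    term : ∀ e i b → (if b then c e - c' e else + 0) * lookup (E e) i ≡
                     (if b then (c e - c' e) * lookup (E e) i else + 0)
    term e i true  = refl
    term e i false = refl
    δ-relation : ∀ i → Σℤ (λ e → δ e * lookup (E e) i) ≡ + 0
    δ-relation i = trans (Σℤ-cong (λ e → term e i (lookup A e)))
                         (trans (comb-- c c' i) (ℤP.i≡j⇒i-j≡0 (same i)))

record FracRep (E : Fin m → Point n) (A : Subset m) (bound : ℕ → Fin m → ℕ) (x : Point n) : Set where
  constructor fracRep
  field
    den       : ℕ
    num       : Fin m → ℕ
    num<bound : ∀ e → lookup A e ≡ true → num e < bound den e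
    scaled    : ∀ i → + suc den * lookup x i ≡ comb E A (λ e → + num e) i

-- Integer points of the half-open parallelepiped Π(A)^◇ = {Σ_{e∈A} λ_e E_e : 0 ≤ λ_e < 1}.
InPara : (E : Fin m → Point n) (A : Subset m) → Point n → Set
InPara E A = FracRep E A (λ d _ → suc d)

-- A point of Π(A)^◇ with the prescribed denominator 1+d and numerator vector c, every
-- entry of which (also outside A) lies in [0, 1+d); this finitary form is decidable.
ParaNum : (E : Fin m → Point n) (A : Subset m) (d : ℕ) → Point n → Vec ℕ m → Set
ParaNum E A d z c =
  (∀ e → lookup c e < suc d) × (∀ i → + suc d * lookup z i ≡ comb E A (λ e → + lookup c e) i)

paraNum⇒para : ∀ {E : Fin m → Point n} {A d z} c → ParaNum E A d z c → InPara E A z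
paraNum⇒para {d = d} c (c<D , scaled) = fracRep d (lookup c) (λ e _ → c<D e) scaled

module _ (E : Fin m → Point n) (A : Subset m) where

  shift-up : ∀ (D w : ℤ) (r q : Fin m → ℤ) i → D * w ≡ comb E A r i →
             D * (w + comb E A q i) ≡ comb E A (λ e → r e + q e * D) i
  shift-up D w r q i Dw = begin
    D * (w + comb E A q i)                        ≡⟨ ℤP.*-distribˡ-+ D w _ ⟩
    D * w + D * comb E A q i                      ≡⟨ cong₂ _+_ Dw (sym (comb-* E A D q i)) ⟩
    comb E A r i + comb E A (λ e → D * q e) i     ≡⟨ sym (comb-+ E A r _ i) ⟩
    comb E A (λ e → r e + D * q e) i              ≡⟨ comb-cong E A _ _ (λ e _ → cong (_+_ (r e)) (ℤP.*-comm D (q e))) i ⟩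
    comb E A (λ e → r e + q e * D) i              ∎
    where open ≡-Reasoning

  shift-down : ∀ (D w : ℤ) (r q : Fin m → ℤ) i → D * w ≡ comb E A (λ e → r e + q e * D) i →
               D * (w - comb E A q i) ≡ comb E A r i
  shift-down D w r q i Dw = begin
    D * (w - comb E A q i)                                       ≡⟨ distrib D w _ ⟩
    D * w - D * comb E A q i                                     ≡⟨ cong₂ _-_ Dw (sym (comb-* E A D q i)) ⟩
    comb E A (λ e → r e + q e * D) i - comb E A (λ e → D * q e) i ≡⟨ sym (comb-- E A (λ e → r e + q e * D) (λ e → D * q e) i) ⟩
    comb E A (λ e → (r e + q e * D) - D * q e) i                 ≡⟨ comb-cong E A _ _ (λ e _ → cancel (r e) (q e) D) i ⟩
    comb E A r i                                                 ∎
    where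
    open ≡-Reasoning
    distrib : ∀ a b c → a * (b - c) ≡ a * b - a * c
    distrib = solve-∀
    cancel : ∀ r q d → (r + q * d) - d * q ≡ r
    cancel = solve-∀

small-difference : ∀ N a b (g : ℤ) → a < N → b < N → + a - + b ≡ + N * g → g ≡ + 0
small-difference N a b g a<N b<N diff = ℤP.∣i∣≡0⇒i≡0 (ℕP.n<1⇒n≡0 (ℕP.*-cancelˡ-< N _ _ N∣g∣<N))
  where
  open ℕP.≤-Reasoning
  N∣g∣<N : N ℕ.* ∣ g ∣ < N ℕ.* 1
  N∣g∣<N = begin-strict
    N ℕ.* ∣ g ∣       ≡⟨ sym (ℤP.abs-* (+ N) g) ⟩
    ∣ + N * g ∣       ≡⟨ cong ∣_∣ (trans (sym diff) (ℤP.m-n≡m⊖n a b)) ⟩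
    ∣ a ⊖ b ∣         ≤⟨ ℤP.∣m⊝n∣≤m⊔n a b ⟩
    a ℕ.⊔ b           <⟨ ℕP.⊔-lub a<N b<N ⟩
    N                 ≡⟨ sym (ℕP.*-identityʳ N) ⟩
    N ℕ.* 1           ∎

module _ {E : Fin m → Point n} (indep : LinIndep E) {A : Subset m} where

  para-unique : ∀ {z z'} → InPara E A z → InPara E A z' → CongMod E A z z' → z ≡ z'
  para-unique {z} {z'} (fracRep d c c<D Dz) (fracRep d' c' c'<D' D'z') (g , z-z'≡) =
    vec-ext z z' λ i → ℤP.i-j≡0⇒i≡j _ _
      (trans (sym (VecP.lookup-zipWith _-_ i z z')) (trans (z-z'≡ i) (comb-zero E A g g≡0 i)))
    where
    D D' N : ℕ
    D = suc d
    D' = suc d'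
    N = D' ℕ.* D
    cross : Fin m → ℤ
    cross e = + (D' ℕ.* c e) - + (D ℕ.* c' e)
    rearrange : ∀ a b x y → a * (b * x) - b * (a * y) ≡ (a * b) * (x - y)
    rearrange = solve-∀
    cross-comb : ∀ i → comb E A cross i ≡ comb E A (λ e → + N * g e) i
    cross-comb i = begin
      comb E A cross i
        ≡⟨ comb-cong E A _ (λ e → + D' * + c e - + D * + c' e)
             (λ e _ → cong₂ _-_ (ℤP.pos-* D' (c e)) (ℤP.pos-* D (c' e))) i ⟩
      comb E A (λ e → + D' * + c e - + D * + c' e) i
        ≡⟨ comb-- E A (λ e → + D' * + c e) (λ e → + D * + c' e) i ⟩
      comb E A (λ e → + D' * + c e) i - comb E A (λ e → + D * + c' e) i
        ≡⟨ cong₂ _-_ (comb-* E A (+ D') (λ e → + c e) i) (comb-* E A (+ D) (λ e → + c' e) i) ⟩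
      + D' * comb E A (λ e → + c e) i - + D * comb E A (λ e → + c' e) i
        ≡⟨ cong₂ (λ u v → + D' * u - + D * v) (sym (Dz i)) (sym (D'z' i)) ⟩
      + D' * (+ D * lookup z i) - + D * (+ D' * lookup z' i)
        ≡⟨ rearrange (+ D') (+ D) (lookup z i) (lookup z' i) ⟩
      (+ D' * + D) * (lookup z i - lookup z' i)
        ≡⟨ cong₂ _*_ (sym (ℤP.pos-* D' D)) (sym (VecP.lookup-zipWith _-_ i z z')) ⟩
      + N * lookup (zipWith _-_ z z') i
        ≡⟨ cong (+ N *_) (z-z'≡ i) ⟩
      + N * comb E A g i
        ≡⟨ sym (comb-* E A (+ N) g i) ⟩
      comb E A (λ e → + N * g e) i ∎
      where open ≡-Reasoning
    g≡0 : ∀ e → lookup A e ≡ true → g e ≡ + 0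
    g≡0 e inA = small-difference N (D' ℕ.* c e) (D ℕ.* c' e) (g e)
      (ℕP.*-monoʳ-< D' (c<D e inA))
      (subst (D ℕ.* c' e <_) (ℕP.*-comm D D') (ℕP.*-monoʳ-< D (c'<D' e inA)))
      (comb-injective E A indep cross (λ e → + N * g e) cross-comb e inA)

record Reduction {m n} (E : Fin m → Point n) (A : Subset m) (d : ℕ) (x : Point n) : Set where
  constructor reduction
  field
    point      : Point n
    numerators : Vec ℕ m
    isPara     : ParaNum E A d point numerators
    congruent  : CongMod E A x point

reduce : ∀ {m n} (E : Fin m → Point n) (A : Subset m) (d : ℕ) (x : Point n) (cc : Fin m → ℤ) →
         (∀ i → + suc d * lookup x i ≡ comb E A cc i) → Reduction E A d x
reduce {m} {n} E A d x cc Dx = reduction z c (c<D , Dz) (q , x-z≡)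
  where
  D : ℤ
  D = + suc d
  q : Fin m → ℤ
  q e = cc e ℤDM./ D
  c : Vec ℕ m
  c = tabulate (λ e → cc e ℤDM.% D)
  z : Point n
  z = tabulate (λ i → lookup x i - comb E A q i)
  c<D : ∀ e → lookup c e < suc d
  c<D e = subst (_< suc d) (sym (VecP.lookup∘tabulate _ e)) (ℤDM.n%d<d (cc e) D)
  Dz : ∀ i → D * lookup z i ≡ comb E A (λ e → + lookup c e) i
  Dz i = begin
    D * lookup z i                      ≡⟨ cong (D *_) (VecP.lookup∘tabulate _ i) ⟩
    D * (lookup x i - comb E A q i)     ≡⟨ shift-down E A D (lookup x i) (λ e → + (cc e ℤDM.% D)) q i
                                             (trans (Dx i) (comb-cong E A cc _ (λ e _ → ℤDM.a≡a%n+[a/n]*n (cc e) D) i)) ⟩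
    comb E A (λ e → + (cc e ℤDM.% D)) i ≡⟨ comb-cong E A _ _ (λ e _ → cong +_ (sym (VecP.lookup∘tabulate _ e))) i ⟩
    comb E A (λ e → + lookup c e) i     ∎
    where open ≡-Reasoning
  undo : ∀ a w → a - (a - w) ≡ w
  undo = solve-∀
  x-z≡ : ∀ i → lookup (zipWith _-_ x z) i ≡ comb E A q i
  x-z≡ i = trans (VecP.lookup-zipWith _-_ i x z)
             (trans (cong (_-_ (lookup x i)) (VecP.lookup∘tabulate _ i)) (undo (lookup x i) _))

_·ₚ_ : ℕ → Point n → Point n
t ·ₚ z = Data.Vec.map (λ u → + t * u) z

multiple-scaled : ∀ (E : Fin m → Point n) A {d z} (c : Fin m → ℤ) t →
                  (∀ i → + suc d * lookup z i ≡ comb E A c i) →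
                  ∀ i → + suc d * lookup (t ·ₚ z) i ≡ comb E A (λ e → + t * c e) i
multiple-scaled E A {d} {z} c t Dz i = begin
  + suc d * lookup (t ·ₚ z) i      ≡⟨ cong (+ suc d *_) (VecP.lookup-map i _ z) ⟩
  + suc d * (+ t * lookup z i)     ≡⟨ swap (+ suc d) (+ t) (lookup z i) ⟩
  + t * (+ suc d * lookup z i)     ≡⟨ cong (+ t *_) (Dz i) ⟩
  + t * comb E A c i               ≡⟨ sym (comb-* E A (+ t) c i) ⟩
  comb E A (λ e → + t * c e) i     ∎
  where
  open ≡-Reasoning
  swap : ∀ a b x → a * (b * x) ≡ b * (a * x)
  swap = solve-∀

congruent-multiples : ∀ (E : Fin m → Point n) A {z y : Point n} {t t'} → t ≤ t' →
                      CongMod E A (t ·ₚ z) y → CongMod E A (t' ·ₚ z) y →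
                      ∃ λ (g : Fin m → ℤ) → ∀ i → + (t' ∸ t) * lookup z i ≡ comb E A g i
congruent-multiples E A {z} {y} {t} {t'} t≤t' (g , tz-y) (g' , t'z-y) = (λ e → g' e - g e) , order
  where
  difference : ∀ s i → lookup (zipWith _-_ (s ·ₚ z) y) i ≡ + s * lookup z i - lookup y i
  difference s i = trans (VecP.lookup-zipWith _-_ i (s ·ₚ z) y) (cong (_- lookup y i) (VecP.lookup-map i _ z))
  telescope : ∀ a b x w → (b - a) * x ≡ (b * x - w) - (a * x - w)
  telescope = solve-∀
  order : ∀ i → + (t' ∸ t) * lookup z i ≡ comb E A (λ e → g' e - g e) i
  order i = begin
    + (t' ∸ t) * lookup z i
      ≡⟨ cong (_* lookup z i) (sym (trans (ℤP.m-n≡m⊖n t' t) (ℤP.⊖-≥ t≤t'))) ⟩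
    (+ t' - + t) * lookup z i
      ≡⟨ telescope (+ t) (+ t') (lookup z i) (lookup y i) ⟩
    (+ t' * lookup z i - lookup y i) - (+ t * lookup z i - lookup y i)
      ≡⟨ cong₂ _-_ (trans (sym (difference t' i)) (t'z-y i)) (trans (sym (difference t i)) (tz-y i)) ⟩
    comb E A g' i - comb E A g i
      ≡⟨ sym (comb-- E A g' g i) ⟩
    comb E A (λ e → g' e - g e) i ∎
    where open ≡-Reasoning

Πℕ : (Fin m → ℕ) → ℕ
Πℕ {zero}  f = 1
Πℕ {suc m} f = f zero ℕ.* Πℕ (λ i → f (suc i))

Πℕ-cong : {f g : Fin m → ℕ} → (∀ e → f e ≡ g e) → Πℕ f ≡ Πℕ g
Πℕ-cong {zero}  h = refl
Πℕ-cong {suc m} h = cong₂ ℕ._*_ (h zero) (Πℕ-cong (λ e → h (suc e)))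

factor∣Πℕ : (f : Fin m → ℕ) (e : Fin m) → f e ∣ Πℕ f
factor∣Πℕ f zero    = m∣m*n _
factor∣Πℕ f (suc e) = ∣-trans (factor∣Πℕ (λ i → f (suc i)) e) (n∣m*n (f zero))

Πℕ-nonZero : (f : Fin m → ℕ) → (∀ e → ℕ.NonZero (f e)) → ℕ.NonZero (Πℕ f)
Πℕ-nonZero {zero}  f _  = _
Πℕ-nonZero {suc m} f nz = ℕP.m*n≢0 (f zero) _ {{nz zero}} {{Πℕ-nonZero (λ i → f (suc i)) (λ i → nz (suc i))}}

vectors : (Fin m → List X) → List (Vec X m)
vectors {zero}  L = [] ∷ []
vectors {suc m} L = cartesianProductWith _∷_ (L zero) (vectors (λ i → L (suc i)))

∈-vectors⁺ : (L : Fin m → List X) (v : Vec X m) → (∀ i → lookup v i ∈ L i) → v ∈ vectors L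
∈-vectors⁺ {zero}  L [] h      = here refl
∈-vectors⁺ {suc m} L (x ∷ v) h =
  ∈P.∈-cartesianProductWith⁺ _∷_ (h zero) (∈-vectors⁺ (λ i → L (suc i)) v (λ i → h (suc i)))

∈-vectors⁻ : (L : Fin m → List X) (v : Vec X m) → v ∈ vectors L → ∀ i → lookup v i ∈ L i
∈-vectors⁻ {suc m} L v v∈ i with ∈P.∈-cartesianProductWith⁻ _∷_ (L zero) (vectors (λ i → L (suc i))) v∈
∈-vectors⁻ {suc m} L .(x ∷ w) v∈ zero    | x , w , x∈ , w∈ , refl = x∈
∈-vectors⁻ {suc m} L .(x ∷ w) v∈ (suc i) | x , w , x∈ , w∈ , refl = ∈-vectors⁻ (λ i → L (suc i)) w w∈ i

vectors-unique : (L : Fin m → List X) → (∀ i → Unique (L i)) → Unique (vectors L)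
vectors-unique {zero}  L h = [] ∷ []
vectors-unique {suc m} L h =
  UniqueP.cartesianProductWith⁺ _∷_ VecP.∷-injective (h zero) (vectors-unique (λ i → L (suc i)) (λ i → h (suc i)))

length-cartesianProductWith : (f : X → Y → Z) (xs : List X) (ys : List Y) →
                              length (cartesianProductWith f xs ys) ≡ length xs ℕ.* length ys
length-cartesianProductWith f []       ys = refl
length-cartesianProductWith f (x ∷ xs) ys =
  trans (ListP.length-++ (map (f x) ys))
        (cong₂ ℕ._+_ (ListP.length-map (f x) ys) (length-cartesianProductWith f xs ys))

length-vectors : (L : Fin m → List X) → length (vectors L) ≡ Πℕ (λ i → length (L i))
length-vectors {zero}  L = refl
length-vectors {suc m} L = trans (length-cartesianProductWith _∷_ (L zero) _)
                                 (cong (length (L zero) ℕ.*_) (length-vectors (λ i → L (suc i))))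

map-unique : {f : X → Y} {xs : List X} → Unique xs →
             (∀ {x y} → x ∈ xs → y ∈ xs → f x ≡ f y → x ≡ y) → Unique (map f xs)
map-unique {xs = []}     _          _   = []
map-unique {xs = x ∷ xs} (x∉ ∷ uniq) inj =
  AllP.map⁺ (All.tabulate (λ y∈ fx≡fy → All.lookup x∉ y∈ (inj (here refl) (there y∈) fx≡fy)))
  ∷ map-unique uniq (λ p q → inj (there p) (there q))

unique⇒unrelated : {R : X → X → Set} {xs : List X} → Unique xs →
                   (∀ {a b} → a ∈ xs → b ∈ xs → R a b → a ≡ b) → AllPairs (λ a b → ¬ R a b) xs
unique⇒unrelated {xs = []}     _           _     = []
unique⇒unrelated {xs = x ∷ xs} (x∉ ∷ uniq) R⇒≡ =
  All.tabulate (λ y∈ r → All.lookup x∉ y∈ (R⇒≡ (here refl) (there y∈) r))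
  ∷ unique⇒unrelated uniq (λ p q → R⇒≡ (there p) (there q))

interval : ℕ → List ℤ
interval B = map +_ (upTo (suc B)) ++ map -[1+_] (upTo B)

∈-interval : ∀ B (x : ℤ) → ∣ x ∣ ≤ B → x ∈ interval B
∈-interval B (+ t)      h = ∈P.∈-++⁺ˡ (∈P.∈-map⁺ +_ (∈P.∈-upTo⁺ (ℕ.s≤s h)))
∈-interval B -[1+ t ]   h = ∈P.∈-++⁺ʳ (map +_ (upTo (suc B))) (∈P.∈-map⁺ -[1+_] (∈P.∈-upTo⁺ h))

interval-unique : ∀ B → Unique (interval B)
interval-unique B = UniqueP.++⁺ (UniqueP.map⁺ ℤP.+-injective (UniqueP.upTo⁺ (suc B)))
                                (UniqueP.map⁺ ℤP.-[1+-injective (UniqueP.upTo⁺ B)) disjoint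
  where
  disjoint : ∀ {v} → ¬ (v ∈ map +_ (upTo (suc B)) × v ∈ map -[1+_] (upTo B))
  disjoint (p , q) with ∈P.∈-map⁻ +_ p | ∈P.∈-map⁻ -[1+_] q
  ... | _ , _ , refl | _ , _ , ()

Σℕ : (Fin m → ℕ) → ℕ
Σℕ {zero}  f = 0
Σℕ {suc m} f = f zero ℕ.+ Σℕ (λ i → f (suc i))

abs-Σℤ : (f : Fin m → ℤ) → ∣ Σℤ f ∣ ≤ Σℕ (λ e → ∣ f e ∣)
abs-Σℤ {zero}  f = z≤n
abs-Σℤ {suc m} f = ℕP.≤-trans (ℤP.∣i+j∣≤∣i∣+∣j∣ (f zero) _) (ℕP.+-monoʳ-≤ ∣ f zero ∣ (abs-Σℤ (λ e → f (suc e))))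

Σℕ-mono : (f g : Fin m → ℕ) → (∀ e → f e ≤ g e) → Σℕ f ≤ Σℕ g
Σℕ-mono {zero}  f g h = z≤n
Σℕ-mono {suc m} f g h = ℕP.+-mono-≤ (h zero) (Σℕ-mono _ _ (λ e → h (suc e)))

Σℕ-* : (a : ℕ) (f : Fin m → ℕ) → Σℕ (λ e → a ℕ.* f e) ≡ a ℕ.* Σℕ f
Σℕ-* {zero}  a f = sym (ℕP.*-zeroʳ a)
Σℕ-* {suc m} a f = trans (cong (a ℕ.* f zero ℕ.+_) (Σℕ-* a (λ e → f (suc e))))
                         (sym (ℕP.*-distribˡ-+ a (f zero) _))

module ParaPoints {m n} (E : Fin m → Point n) (indep : LinIndep E) (A : Subset m) where

  -- Points of Π(A)^◇ lie in the box |z_i| ≤ Σ_e |E_e,i|, since all coefficients are in [0, 1).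
  radius : Fin n → ℕ
  radius i = Σℕ (λ e → ∣ lookup (E e) i ∣)

  box : List (Point n)
  box = vectors (λ i → interval (radius i))

  para-bounded : ∀ {z} → InPara E A z → ∀ i → ∣ lookup z i ∣ ≤ radius i
  para-bounded {z} (fracRep d c c<D Dz) i = ℕP.*-cancelˡ-≤ (suc d) (begin
    suc d ℕ.* ∣ lookup z i ∣                  ≡⟨ sym (ℤP.abs-* (+ suc d) (lookup z i)) ⟩
    ∣ + suc d * lookup z i ∣                  ≡⟨ cong ∣_∣ (Dz i) ⟩
    ∣ comb E A (λ e → + c e) i ∣              ≤⟨ abs-Σℤ {m} _ ⟩
    Σℕ (λ e → ∣ (if lookup A e then + c e * lookup (E e) i else + 0) ∣) ≤⟨ Σℕ-mono {m} _ _ (λ e → term e (lookup A e) refl) ⟩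
    Σℕ (λ e → suc d ℕ.* ∣ lookup (E e) i ∣)   ≡⟨ Σℕ-* {m} (suc d) _ ⟩
    suc d ℕ.* radius i                         ∎)
    where
    open ℕP.≤-Reasoning
    term : ∀ e b → lookup A e ≡ b →
           ∣ (if b then + c e * lookup (E e) i else + 0) ∣ ≤ suc d ℕ.* ∣ lookup (E e) i ∣
    term e true  inA = ℕP.≤-trans (ℕP.≤-reflexive (ℤP.abs-* (+ c e) (lookup (E e) i)))
                                  (ℕP.*-monoˡ-≤ ∣ lookup (E e) i ∣ (ℕP.<⇒≤ (c<D e inA)))
    term e false _   = z≤n

  para⇒box : ∀ {z} → InPara E A z → z ∈ box
  para⇒box p = ∈-vectors⁺ _ _ (λ i → ∈-interval _ _ (para-bounded p i))

  M : ℕ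
  M = length box

  BoundedOrder : Point n → Set
  BoundedOrder z = ∃ λ s → 0 < s × s ≤ M × ∃ λ (g : Fin m → ℤ) → ∀ i → + s * lookup z i ≡ comb E A g i

  -- Pigeonhole: the reductions y_t of the multiples t·z, t = 0, …, M, all lie in the box of
  -- M points, so y_a = y_b for some a < b, and then (b - a)·z ∈ ⟨A⟩.
  para-order : ∀ {z} → InPara E A z → BoundedOrder z
  para-order {z} (fracRep d c _ Dz) = collision (FinP.pigeonhole (ℕP.n<1+n M) (λ t → index (toℕ t)))
    where
    reduced : ∀ t → Reduction E A d (t ·ₚ z)
    reduced t = reduce E A d (t ·ₚ z) (λ e → + t * + c e) (multiple-scaled E A {d} {z} (λ e → + c e) t Dz)
    y : ℕ → Point n
    y t = Reduction.point (reduced t)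
    y∈box : ∀ t → y t ∈ box
    y∈box t = para⇒box (paraNum⇒para (Reduction.numerators (reduced t)) (Reduction.isPara (reduced t)))
    index : ℕ → Fin M
    index t = Any.index (y∈box t)
    y-index : ∀ t → y t ≡ Data.List.lookup box (index t)
    y-index t = AnyP.lookup-index (y∈box t)
    collision : (∃₂ λ (a b : Fin (suc M)) → a Data.Fin.< b × index (toℕ a) ≡ index (toℕ b)) → BoundedOrder z
    collision (a , b , a<b , same) =
      toℕ b ∸ toℕ a , ℕP.m<n⇒0<n∸m a<b , ℕP.≤-trans (ℕP.m∸n≤m (toℕ b) (toℕ a)) (ℕP.≤-pred (FinP.toℕ<n b)) ,
      congruent-multiples E A {z} (ℕP.<⇒≤ a<b) (Reduction.congruent (reduced (toℕ a)))
        (subst (CongMod E A (toℕ b ·ₚ z)) (sym ya≡yb) (Reduction.congruent (reduced (toℕ b))))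
      where
      ya≡yb : y (toℕ a) ≡ y (toℕ b)
      ya≡yb = trans (y-index (toℕ a)) (trans (cong (Data.List.lookup box) same) (sym (y-index (toℕ b))))

  -- The common denominator K = M! = 1 + Kd is a multiple of every order s ≤ M.
  Kd : ℕ
  Kd = ℕ.pred (M !)

  ∣K : ∀ {s} → 0 < s → s ≤ M → s ∣ suc Kd
  ∣K {suc s} _ s≤M = subst (suc s ∣_) (sym (ℕP.suc-pred (M !) {{ℕP._!≢0 M}}))
    (∣-trans (divides (s !) (ℕP.*-comm (suc s) (s !))) (m≤n⇒m!∣n! s≤M))

  para⇒paraNumK : ∀ {z} → InPara E A z → ∃ λ c → ParaNum E A Kd z c
  para⇒paraNumK {z} para = clear (para-order para)
    where
    clear : BoundedOrder z → ∃ λ c → ParaNum E A Kd z c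
    clear (s , 0<s , s≤M , g , sz) = subst (λ w → ∃ (ParaNum E A Kd w)) (sym z≡) (numerators , isPara)
      where
      u : ℕ
      u = quotient (∣K 0<s s≤M)
      Kz : ∀ i → + suc Kd * lookup z i ≡ comb E A (λ e → + u * g e) i
      Kz i = begin
        + suc Kd * lookup z i       ≡⟨ cong (λ k → + k * lookup z i) (m∣n⇒n≡quotient*m (∣K 0<s s≤M)) ⟩
        + (u ℕ.* s) * lookup z i    ≡⟨ cong (_* lookup z i) (ℤP.pos-* u s) ⟩
        + u * + s * lookup z i      ≡⟨ ℤP.*-assoc (+ u) (+ s) (lookup z i) ⟩
        + u * (+ s * lookup z i)    ≡⟨ cong (+ u *_) (sz i) ⟩
        + u * comb E A g i          ≡⟨ sym (comb-* E A (+ u) g i) ⟩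
        comb E A (λ e → + u * g e) i ∎
        where open ≡-Reasoning
      open Reduction (reduce E A Kd z (λ e → + u * g e) Kz)
      z≡ : z ≡ point
      z≡ = para-unique indep para (paraNum⇒para numerators isPara) congruent

  candidates : List (Vec ℕ m)
  candidates = vectors (λ _ → upTo (suc Kd))

  ScaledByK : Point n → Vec ℕ m → Set
  ScaledByK z c = ∀ i → + suc Kd * lookup z i ≡ comb E A (λ e → + lookup c e) i

  HasNumeratorsK : Point n → Set
  HasNumeratorsK z = Any (ScaledByK z) candidates

  hasNumeratorsK? : ∀ z → Dec (HasNumeratorsK z)
  hasNumeratorsK? z = Any.any? (λ c → FinP.all? (λ i → + suc Kd * lookup z i ℤ.≟ comb E A (λ e → + lookup c e) i)) candidates

  paraPoints : List (Point n)
  paraPoints = filter hasNumeratorsK? box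

  paraPoints-unique : Unique paraPoints
  paraPoints-unique = UniqueP.filter⁺ hasNumeratorsK? (vectors-unique _ (λ i → interval-unique (radius i)))

  ∈paraPoints⁺ : ∀ {z} → InPara E A z → z ∈ paraPoints
  ∈paraPoints⁺ {z} para = ∈P.∈-filter⁺ hasNumeratorsK? (para⇒box para) (hasNumerators (para⇒paraNumK para))
    where
    hasNumerators : (∃ λ c → ParaNum E A Kd z c) → HasNumeratorsK z
    hasNumerators (c , c<K , Kz) =
      Any.map (λ c≡ → subst (ScaledByK z) c≡ Kz) (∈-vectors⁺ _ c (λ e → ∈P.∈-upTo⁺ (c<K e)))

  ∈paraPoints⁻ : ∀ {z} → z ∈ paraPoints → InPara E A z
  ∈paraPoints⁻ {z} z∈ = fromWitness (find (proj₂ (∈P.∈-filter⁻ hasNumeratorsK? {xs = box} z∈)))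
    where
    fromWitness : (∃ λ c → c ∈ candidates × ScaledByK z c) → InPara E A z
    fromWitness (c , c∈ , Kz) = paraNum⇒para c ((λ e → ∈P.∈-upTo⁻ (∈-vectors⁻ _ c c∈ e)) , Kz)

-- Integer points of the half-open zonotope 𝒵(k·A)^◇: x = Σ_{e∈A} λ_e k_e E_e with
-- λ_e = num_e / ((1+d) k_e) ∈ [0, 1).
InZono : ∀ {m n} (E : Fin m → Point n) (A : Subset m) (k : Fin m → ℕ) → Point n → Set
InZono E A k = FracRep E A (λ d e → suc d ℕ.* k e)

module ZonoPoints {m n} (E : Fin m → Point n) (indep : LinIndep E) (A : Subset m) (k : Fin m → ℕ) where
  open ParaPoints E indep A

  -- 𝒵(k·A)^◇ is tiled by the translates of Π(A)^◇ by Σ_{e∈A} j_e E_e with 0 ≤ j_e < k_e.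
  digits : Fin m → List ℕ
  digits e = if lookup A e then upTo (k e) else (0 ∷ [])

  digitVectors : List (Vec ℕ m)
  digitVectors = vectors digits

  translate : Vec ℕ m × Point n → Point n
  translate (j , z) = zipWith _+_ z (tabulate (comb E A (λ e → + lookup j e)))

  zonoPoints : List (Point n)
  zonoPoints = map translate (cartesianProduct digitVectors paraPoints)

  lookup-translate : ∀ j z i → lookup (translate (j , z)) i ≡ lookup z i + comb E A (λ e → + lookup j e) i
  lookup-translate j z i = trans (VecP.lookup-zipWith _+_ i z _) (cong (_+_ (lookup z i)) (VecP.lookup∘tabulate _ i))

  digit<k : ∀ {j} → j ∈ digitVectors → ∀ e → lookup A e ≡ true → lookup j e < k e
  digit<k {j} j∈ e inA = ∈P.∈-upTo⁻ (subst (λ b → lookup j e ∈ (if b then upTo (k e) else (0 ∷ []))) inA (∈-vectors⁻ digits j j∈ e))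

  digit-outside : ∀ {j} → j ∈ digitVectors → ∀ e → lookup A e ≡ false → lookup j e ≡ 0
  digit-outside {j} j∈ e ∉A = single (subst (λ b → lookup j e ∈ (if b then upTo (k e) else (0 ∷ []))) ∉A (∈-vectors⁻ digits j j∈ e))
    where
    single : ∀ {x} → x ∈ (0 ∷ []) → x ≡ 0
    single (here x≡0) = x≡0

  translate-zono : ∀ {j z} → j ∈ digitVectors → InPara E A z → InZono E A k (translate (j , z))
  translate-zono {j} {z} j∈ (fracRep d c c<D Dz) = fracRep d numerator numerator< scaled
    where
    D : ℕ
    D = suc d
    numerator : Fin m → ℕ
    numerator e = c e ℕ.+ lookup j e ℕ.* D
    numerator< : ∀ e → lookup A e ≡ true → numerator e < D ℕ.* k e
    numerator< e inA = ℕP.<-≤-trans (ℕP.+-monoˡ-< (lookup j e ℕ.* D) (c<D e inA))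
                         (subst (_≤ D ℕ.* k e) (ℕP.*-comm D (suc (lookup j e))) (ℕP.*-monoʳ-≤ D (digit<k j∈ e inA)))
    cast : ∀ e → + c e + + lookup j e * + D ≡ + numerator e
    cast e = sym (trans (ℤP.pos-+ (c e) _) (cong (_+_ (+ c e)) (ℤP.pos-* (lookup j e) D)))
    scaled : ∀ i → + D * lookup (translate (j , z)) i ≡ comb E A (λ e → + numerator e) i
    scaled i = begin
      + D * lookup (translate (j , z)) i                              ≡⟨ cong (+ D *_) (lookup-translate j z i) ⟩
      + D * (lookup z i + comb E A (λ e → + lookup j e) i)            ≡⟨ shift-up E A (+ D) (lookup z i) (λ e → + c e) (λ e → + lookup j e) i (Dz i) ⟩
      comb E A (λ e → + c e + + lookup j e * + D) i                   ≡⟨ comb-cong E A _ _ (λ e _ → cast e) i ⟩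
      comb E A (λ e → + numerator e) i                                ∎
      where open ≡-Reasoning

  zono-decompose : ∀ {x} → InZono E A k x →
                   ∃ λ j → ∃ λ z → j ∈ digitVectors × InPara E A z × translate (j , z) ≡ x
  zono-decompose {x} (fracRep d c c<Dk Dx) = j , z , j∈ , fracRep d r (λ e _ → ℕDM.m%n<n (c e) D) Dz , x≡
    where
    D : ℕ
    D = suc d
    q r : Fin m → ℕ
    q e = c e ℕ./ D
    r e = c e ℕ.% D
    j : Vec ℕ m
    j = tabulate (λ e → if lookup A e then q e else 0)
    j-inside : ∀ e → lookup A e ≡ true → + lookup j e ≡ + q e
    j-inside e inA = cong +_ (trans (VecP.lookup∘tabulate _ e) (cong (λ b → if b then q e else 0) inA))
    digit : ∀ e b → lookup A e ≡ b → lookup j e ∈ (if b then upTo (k e) else (0 ∷ []))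
    digit e true  inA = subst (_∈ upTo (k e)) (sym (ℤP.+-injective (j-inside e inA)))
                          (∈P.∈-upTo⁺ (ℕDM.m<n*o⇒m/o<n (subst (c e <_) (ℕP.*-comm D (k e)) (c<Dk e inA))))
    digit e false ∉A = here (trans (VecP.lookup∘tabulate _ e) (cong (λ b → if b then q e else 0) ∉A))
    j∈ : j ∈ digitVectors
    j∈ = ∈-vectors⁺ digits j (λ e → digit e (lookup A e) refl)
    z : Point n
    z = tabulate (λ i → lookup x i - comb E A (λ e → + q e) i)
    divmod : ∀ e → + c e ≡ + r e + + q e * + D
    divmod e = trans (cong +_ (ℕDM.m≡m%n+[m/n]*n (c e) D))
                     (trans (ℤP.pos-+ (r e) _) (cong (_+_ (+ r e)) (ℤP.pos-* (q e) D)))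
    Dz : ∀ i → + D * lookup z i ≡ comb E A (λ e → + r e) i
    Dz i = trans (cong (+ D *_) (VecP.lookup∘tabulate _ i))
                 (shift-down E A (+ D) (lookup x i) (λ e → + r e) (λ e → + q e) i (trans (Dx i) (comb-cong E A _ _ (λ e _ → divmod e) i)))
    undo : ∀ a w → (a - w) + w ≡ a
    undo = solve-∀
    x≡ : translate (j , z) ≡ x
    x≡ = vec-ext _ x λ i → begin
      lookup (translate (j , z)) i                          ≡⟨ lookup-translate j z i ⟩
      lookup z i + comb E A (λ e → + lookup j e) i          ≡⟨ cong₂ _+_ (VecP.lookup∘tabulate _ i) (comb-cong E A _ _ j-inside i) ⟩
      (lookup x i - comb E A (λ e → + q e) i) + comb E A (λ e → + q e) i ≡⟨ undo (lookup x i) _ ⟩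
      lookup x i                                            ∎
      where open ≡-Reasoning

  translate-injective : ∀ {j z j' z'} → j ∈ digitVectors → j' ∈ digitVectors → InPara E A z → InPara E A z' →
                        translate (j , z) ≡ translate (j' , z') → (j , z) ≡ (j' , z')
  translate-injective {j} {z} {j'} {z'} j∈ j'∈ para para' same = cong₂ _,_ j≡j' z≡z'
    where
    coeffs coeffs' : Fin m → ℤ
    coeffs e = + lookup j e
    coeffs' e = + lookup j' e
    coordinate : ∀ i → lookup z i + comb E A coeffs i ≡ lookup z' i + comb E A coeffs' i
    coordinate i = trans (sym (lookup-translate j z i)) (trans (cong (λ v → lookup v i) same) (lookup-translate j' z' i))
    rearrange : ∀ a b a' b' → a + b ≡ a' + b' → a - a' ≡ b' - b
    rearrange a b a' b' eq = trans (solve₁ a b a') (trans (cong (_- (a' + b)) eq) (solve₂ a' b' b))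
      where
      solve₁ : ∀ a b a' → a - a' ≡ (a + b) - (a' + b)
      solve₁ = solve-∀
      solve₂ : ∀ a' b' b → (a' + b') - (a' + b) ≡ b' - b
      solve₂ = solve-∀
    cancelˡ : ∀ a b b' → a + b ≡ a + b' → b ≡ b'
    cancelˡ a b b' eq = trans (solve₃ a b) (trans (cong (_- a) eq) (sym (solve₃ a b')))
      where
      solve₃ : ∀ a b → b ≡ (a + b) - a
      solve₃ = solve-∀
    z≡z' : z ≡ z'
    z≡z' = para-unique indep para para'
      ((λ e → coeffs' e - coeffs e) , λ i → trans (VecP.lookup-zipWith _-_ i z z')
                                   (trans (rearrange (lookup z i) (comb E A coeffs i) (lookup z' i) (comb E A coeffs' i) (coordinate i)) (sym (comb-- E A coeffs' coeffs i))))
    j-agree : ∀ e b → lookup A e ≡ b → lookup j e ≡ lookup j' e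
    j-agree e true  inA = ℤP.+-injective (comb-injective E A indep coeffs coeffs'
      (λ i → cancelˡ (lookup z i) _ _ (trans (coordinate i) (cong (λ w → lookup w i + comb E A coeffs' i) (sym z≡z')))) e inA)
    j-agree e false ∉A = trans (digit-outside j∈ e ∉A) (sym (digit-outside j'∈ e ∉A))
    j≡j' : j ≡ j'
    j≡j' = vec-ext j j' (λ e → j-agree e (lookup A e) refl)

  zonoPoints-unique : Unique zonoPoints
  zonoPoints-unique = map-unique (UniqueP.cartesianProduct⁺ (vectors-unique digits digits-unique) paraPoints-unique)
    λ {(j , z)} {(j' , z')} p∈ p'∈ → translate-injective
      (proj₁ (∈P.∈-cartesianProduct⁻ digitVectors paraPoints p∈)) (proj₁ (∈P.∈-cartesianProduct⁻ digitVectors paraPoints p'∈))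
      (∈paraPoints⁻ (proj₂ (∈P.∈-cartesianProduct⁻ digitVectors paraPoints p∈)))
      (∈paraPoints⁻ (proj₂ (∈P.∈-cartesianProduct⁻ digitVectors paraPoints p'∈)))
    where
    digits-unique : ∀ e → Unique (digits e)
    digits-unique e = by-membership (lookup A e)
      where
      by-membership : ∀ b → Unique (if b then upTo (k e) else (0 ∷ []))
      by-membership true  = UniqueP.upTo⁺ (k e)
      by-membership false = UniqueP.upTo⁺ 1

  ∈zonoPoints⁻ : ∀ {x} → x ∈ zonoPoints → InZono E A k x
  ∈zonoPoints⁻ {x} x∈ = fromPair (∈P.∈-map⁻ translate x∈)
    where
    fromPair : (∃ λ p → p ∈ cartesianProduct digitVectors paraPoints × x ≡ translate p) → InZono E A k x
    fromPair ((j , z) , p∈ , refl) = translate-zono (proj₁ (∈P.∈-cartesianProduct⁻ digitVectors paraPoints p∈))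
                                                    (∈paraPoints⁻ (proj₂ (∈P.∈-cartesianProduct⁻ digitVectors paraPoints p∈)))

  ∈zonoPoints⁺ : ∀ {x} → InZono E A k x → x ∈ zonoPoints
  ∈zonoPoints⁺ {x} zono = fromDecomposition (zono-decompose zono)
    where
    fromDecomposition : (∃ λ j → ∃ λ z → j ∈ digitVectors × InPara E A z × translate (j , z) ≡ x) → x ∈ zonoPoints
    fromDecomposition (j , z , j∈ , para , refl) = ∈P.∈-map⁺ translate (∈P.∈-cartesianProduct⁺ j∈ (∈paraPoints⁺ para))

  length-zonoPoints : length zonoPoints ≡ Πℕ (λ e → if lookup A e then k e else 1) ℕ.* length paraPoints
  length-zonoPoints = begin
    length zonoPoints                                           ≡⟨ ListP.length-map translate (cartesianProduct digitVectors paraPoints) ⟩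
    length (cartesianProduct digitVectors paraPoints)           ≡⟨ length-cartesianProductWith _,_ digitVectors paraPoints ⟩
    length digitVectors ℕ.* length paraPoints                   ≡⟨ cong (ℕ._* length paraPoints) (length-vectors digits) ⟩
    Πℕ (λ e → length (digits e)) ℕ.* length paraPoints          ≡⟨ cong (ℕ._* length paraPoints) (Πℕ-cong (λ e → length-digits e (lookup A e) refl)) ⟩
    Πℕ (λ e → if lookup A e then k e else 1) ℕ.* length paraPoints ∎
    where
    open ≡-Reasoning
    length-digits : ∀ e b → lookup A e ≡ b → length (if b then upTo (k e) else (0 ∷ [])) ≡ (if b then k e else 1)
    length-digits e true  _ = ListP.length-upTo (k e)
    length-digits e false _ = refl

-- m(A) = |(ℤ^n/⟨A⟩)_tor| is the number of integer points of Π(A)^◇.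
module TorsionPoints {m n} (E : Fin m → Point n) (indep : LinIndep E) (A : Subset m) where
  open ParaPoints E indep A

  para⇒torsion : ∀ {z} → InPara E A z → Torsion E A z
  para⇒torsion {z} (fracRep d c _ Dz) = d , (λ e → + c e) , (λ i → trans (VecP.lookup-map i _ z) (Dz i))

  torsion⇒represented : ∀ x → Torsion E A x → Any (CongMod E A x) paraPoints
  torsion⇒represented x (d , cc , Dx) = Any.map (λ z≡ → subst (CongMod E A x) z≡ congruent) (∈paraPoints⁺ (paraNum⇒para numerators isPara))
    where open Reduction (reduce E A d x cc (λ i → trans (sym (VecP.lookup-map i _ x)) (Dx i)))

  paraPoints-torsionCard : TorsionCard E A (length paraPoints)
  paraPoints-torsionCard =
    paraPoints , refl , All.tabulate (λ z∈ → para⇒torsion (∈paraPoints⁻ z∈)) ,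
    unique⇒unrelated paraPoints-unique (λ z∈ z'∈ → para-unique indep (∈paraPoints⁻ z∈) (∈paraPoints⁻ z'∈)) ,
    torsion⇒represented

-- Fraction p a d: the rational p equals a/(1+d), compared through unnormalised representatives.
Fraction : ℚ → ℤ → ℕ → Set
Fraction p a d = ℚ.toℚᵘ p ℚᵘ.≃ mkℚᵘ a d

fraction-/ : ∀ a d → Fraction (a ℚ./ suc d) a d
fraction-/ a d = ℚP.toℚᵘ-fromℚᵘ (mkℚᵘ a d)

fraction-/-nonZero : ∀ a D .{{_ : ℕ.NonZero D}} → Fraction (a ℚ./ D) a (ℕ.pred D)
fraction-/-nonZero a (suc D) = fraction-/ a D

fraction-self : ∀ p → Fraction p (ℚ.↥ p) (ℚ.denominator-1 p)
fraction-self (mkℚ _ _ _) = ℚᵘP.≃-refl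

fraction-0 : ∀ d → Fraction 0ℚ (+ 0) d
fraction-0 d = *≡* refl

fraction-≡ : ∀ {p q a b d d'} → Fraction p a d → Fraction q b d' → a * + suc d' ≡ b * + suc d → p ≡ q
fraction-≡ fp fq cross = ℚP.toℚᵘ-injective (ℚᵘP.≃-trans fp (ℚᵘP.≃-trans (*≡* cross) (ℚᵘP.≃-sym fq)))

fraction-≡⁻¹ : ∀ {p q a b d d'} → Fraction p a d → Fraction q b d' → p ≡ q → a * + suc d' ≡ b * + suc d
fraction-≡⁻¹ fp fq refl with ℚᵘP.≃-trans (ℚᵘP.≃-sym fp) fq
... | *≡* cross = cross

fraction-+ : ∀ {p q a b d d'} → Fraction p a d → Fraction q b d' →
             Fraction (p ℚ.+ q) (a * + suc d' + b * + suc d) (ℕ.pred (suc d ℕ.* suc d'))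
fraction-+ {p} {q} fp fq = ℚᵘP.≃-trans (ℚP.toℚᵘ-homo-+ p q) (ℚᵘP.+-cong fp fq)

fraction-* : ∀ {p q a b d d'} → Fraction p a d → Fraction q b d' →
             Fraction (p ℚ.* q) (a * b) (ℕ.pred (suc d ℕ.* suc d'))
fraction-* {p} {q} fp fq = ℚᵘP.≃-trans (ℚP.toℚᵘ-homo-* p q) (ℚᵘP.*-cong fp fq)

numerator-nonNeg : ∀ p → 0ℚ ℚ.≤ p → ℚ.↥ p ≡ + ∣ ℚ.↥ p ∣
numerator-nonNeg p@(mkℚ _ _ _) 0≤p with ℚP.toℚᵘ-mono-≤ 0≤p
... | ℚᵘ.*≤* 0≤↥p = sym (ℤP.0≤i⇒+∣i∣≡i (subst₂ ℤ._≤_ (ℤP.*-zeroˡ (+ 1)) (ℤP.*-identityʳ _) 0≤↥p))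

numerator<denominator : ∀ p → 0ℚ ℚ.≤ p → p ℚ.< 1ℚ → ∣ ℚ.↥ p ∣ < ℚ.↧ₙ p
numerator<denominator p@(mkℚ _ _ _) 0≤p p<1 with ℚP.toℚᵘ-mono-< p<1
... | ℚᵘ.*<* ↥p<↧p = ℤP.drop‿+<+ (subst₂ ℤ._<_ (trans (ℤP.*-identityʳ _) (numerator-nonNeg p 0≤p)) (ℤP.*-identityˡ _) ↥p<↧p)

Σℚ-common : ∀ {m} d (F : Fin m → ℚ) (f : Fin m → ℤ) → (∀ e → F e ≡ f e ℚ./ suc d) → Σℚ F ≡ Σℤ f ℚ./ suc d
Σℚ-common d F f F≡ = fraction-≡ (sum F f F≡) (fraction-/ (Σℤ f) d) refl
  where
  collect : ∀ a b D → (a * D + b * D) * D ≡ (a + b) * (D * D)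
  collect = solve-∀
  sum : ∀ {m} (F : Fin m → ℚ) (f : Fin m → ℤ) → (∀ e → F e ≡ f e ℚ./ suc d) → Fraction (Σℚ F) (Σℤ f) d
  sum {zero}  F f F≡ = fraction-0 d
  sum {suc m} F f F≡ = ℚᵘP.≃-trans
    (fraction-+ (subst (λ p → Fraction p (f zero) d) (sym (F≡ zero)) (fraction-/ (f zero) d))
                (sum (λ e → F (suc e)) (λ e → f (suc e)) (λ e → F≡ (suc e))))
    (*≡* (trans (collect (f zero) (Σℤ (λ e → f (suc e))) (+ suc d)) (cong ((f zero + Σℤ (λ e → f (suc e))) *_) (sym (ℤP.pos-* (suc d) (suc d))))))

-- One term of the zonotope: if λ = a/(1+n) and a·k·(1+d) = c·(1+n), i.e. λ = c/((1+d)k),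
-- then λ · (k t) = c t/(1+d).
fraction-term : ∀ {p a n'} (k c : ℕ) (t : ℤ) (d : ℕ) → Fraction p a n' → a * + k * + suc d ≡ + c * + suc n' →
                p ℚ.* ((+ k * t) ℚ./ 1) ≡ (+ c * t) ℚ./ suc d
fraction-term {a = a} {n'} k c t d fp cross = fraction-≡ (fraction-* fp (fraction-/ (+ k * t) 0)) (fraction-/ (+ c * t) d) (begin
  (a * (+ k * t)) * + suc d     ≡⟨ regroup₁ a (+ k) t (+ suc d) ⟩
  (a * + k * + suc d) * t       ≡⟨ cong (_* t) cross ⟩
  (+ c * + suc n') * t          ≡⟨ regroup₂ (+ c) (+ suc n') t ⟩
  (+ c * t) * + suc n'          ≡⟨ cong (λ w → (+ c * t) * + suc w) (sym (ℕP.*-identityʳ n')) ⟩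
  (+ c * t) * + suc (n' ℕ.* 1)  ∎)
  where
  open ≡-Reasoning
  regroup₁ : ∀ a k t D → (a * (k * t)) * D ≡ (a * k * D) * t
  regroup₁ = solve-∀
  regroup₂ : ∀ c N t → (c * N) * t ≡ (c * t) * N
  regroup₂ = solve-∀

module ZonoCoordinate {m n} (E : Fin m → Point n) (A : Subset m) (k : Fin m → ℕ)
                      (d : ℕ) (c : Fin m → ℕ) (lam : Fin m → ℚ)
                      (term : ∀ e → lookup A e ≡ true → ∀ t → lam e ℚ.* ((+ k e * t) ℚ./ 1) ≡ (+ c e * t) ℚ./ suc d)
                      (x : Point n) (i : Fin n) where

  zonoSum : ℚ
  zonoSum = Σℚ (λ e → if lookup A e then lam e ℚ.* ((+ k e * lookup (E e) i) ℚ./ 1) else 0ℚ)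

  zonoSum≡ : zonoSum ≡ comb E A (λ e → + c e) i ℚ./ suc d
  zonoSum≡ = Σℚ-common d _ _ (λ e → termwise e (lookup A e) refl)
    where
    termwise : ∀ e b → lookup A e ≡ b →
               (if b then lam e ℚ.* ((+ k e * lookup (E e) i) ℚ./ 1) else 0ℚ) ≡
               (if b then + c e * lookup (E e) i else + 0) ℚ./ suc d
    termwise e true  inA = term e inA (lookup (E e) i)
    termwise e false _   = fraction-≡ (fraction-0 0) (fraction-/ (+ 0) d) refl

  scaled⇒rational : + suc d * lookup x i ≡ comb E A (λ e → + c e) i → lookup x i ℚ./ 1 ≡ zonoSum
  scaled⇒rational scaled = sym (trans zonoSum≡ (fraction-≡ (fraction-/ (comb E A (λ e → + c e) i) d) (fraction-/ (lookup x i) 0)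
    (trans (ℤP.*-identityʳ (comb E A (λ e → + c e) i)) (trans (sym scaled) (ℤP.*-comm (+ suc d) (lookup x i))))))

  rational⇒scaled : lookup x i ℚ./ 1 ≡ zonoSum → + suc d * lookup x i ≡ comb E A (λ e → + c e) i
  rational⇒scaled rational = trans (ℤP.*-comm (+ suc d) (lookup x i))
    (trans (fraction-≡⁻¹ (fraction-/ (lookup x i) 0) (fraction-/ (comb E A (λ e → + c e) i) d) (trans rational zonoSum≡)) (ℤP.*-identityʳ _))

module _ {m n} (E : Fin m → Point n) (A : Subset m) (k : Fin m → ℕ) (k>0 : ∀ e → 0 < k e) where

  instance
    k≢0 : ∀ {e} → ℕ.NonZero (k e)
    k≢0 {e} = ℕ.>-nonZero (k>0 e)

  zono⇒zonotope : ∀ {x} → InZono E A k x → InZonotope E k A x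
  zono⇒zonotope {x} (fracRep d c c<Dk Dx) =
    lam , bounds , λ i → ZonoCoordinate.scaled⇒rational E A k d c lam (λ e _ t → term e t) x i (Dx i)
    where
    nonZero : ∀ e → ℕ.NonZero (suc d ℕ.* k e)
    nonZero e = ℕP.m*n≢0 (suc d) (k e)
    lam : Fin m → ℚ
    lam e = ℚ._/_ (+ c e) (suc d ℕ.* k e) {{nonZero e}}
    fraction-lam : ∀ e → Fraction (lam e) (+ c e) (ℕ.pred (suc d ℕ.* k e))
    fraction-lam e = fraction-/-nonZero (+ c e) (suc d ℕ.* k e) {{nonZero e}}
    denominator : ∀ e → suc (ℕ.pred (suc d ℕ.* k e)) ≡ suc d ℕ.* k e
    denominator e = ℕP.suc-pred (suc d ℕ.* k e) {{nonZero e}}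
    term : ∀ e t → lam e ℚ.* ((+ k e * t) ℚ./ 1) ≡ (+ c e * t) ℚ./ suc d
    term e t = fraction-term (k e) (c e) t d (fraction-lam e) (begin
      + c e * + k e * + suc d                    ≡⟨ ℤP.*-assoc (+ c e) (+ k e) (+ suc d) ⟩
      + c e * (+ k e * + suc d)                  ≡⟨ cong (+ c e *_) (sym (ℤP.pos-* (k e) (suc d))) ⟩
      + c e * + (k e ℕ.* suc d)                  ≡⟨ cong (λ w → + c e * + w) (trans (ℕP.*-comm (k e) (suc d)) (sym (denominator e))) ⟩
      + c e * + suc (ℕ.pred (suc d ℕ.* k e))     ∎)
      where open ≡-Reasoning
    below1 : ∀ e → lookup A e ≡ true → lam e ℚ.< 1ℚ
    below1 e inA = ℚP.toℚᵘ-cancel-< (ℚᵘP.<-respˡ-≃ (ℚᵘP.≃-sym (fraction-lam e)) (ℚᵘ.*<* (subst₂ ℤ._<_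
      (sym (ℤP.*-identityʳ (+ c e))) (sym (ℤP.*-identityˡ _))
      (ℤ.+<+ (subst (c e <_) (sym (denominator e)) (c<Dk e inA))))))
    bounds : ∀ e → e ∈ₛ A → (0ℚ ℚ.≤ lam e) × (lam e ℚ.< 1ℚ)
    bounds e e∈A = ℚP.nonNegative⁻¹ (lam e) {{ℚP.normalize-nonNeg (c e) (suc d ℕ.* k e) {{nonZero e}}}} ,
                   below1 e (VecP.[]=⇒lookup e∈A)

  -- Conversely, clearing the denominators of the λ_e (common denominator ∏ den λ_e).
  zonotope⇒zono : ∀ {x} → InZonotope E k A x → InZono E A k x
  zonotope⇒zono {x} (lam , bounds , rational) =
    fracRep d c c<Dk (λ i → ZonoCoordinate.rational⇒scaled E A k d c lam term x i (rational i))
    where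
    den : Fin m → ℕ
    den e = ℚ.↧ₙ (lam e)
    common : ℕ
    common = Πℕ den
    instance
      common≢0 : ℕ.NonZero common
      common≢0 = Πℕ-nonZero den (λ _ → _)
    d : ℕ
    d = ℕ.pred common
    suc-d : suc d ≡ common
    suc-d = ℕP.suc-pred common
    cofactor : Fin m → ℕ
    cofactor e = quotient (factor∣Πℕ den e)
    common≡ : ∀ e → common ≡ cofactor e ℕ.* den e
    common≡ e = m∣n⇒n≡quotient*m (factor∣Πℕ den e)
    num : Fin m → ℕ
    num e = ∣ ℚ.↥ (lam e) ∣
    c : Fin m → ℕ
    c e = num e ℕ.* cofactor e ℕ.* k e
    0≤lam : ∀ e → lookup A e ≡ true → 0ℚ ℚ.≤ lam e
    0≤lam e inA = proj₁ (bounds e (VecP.lookup⇒[]= e A inA))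
    c<Dk : ∀ e → lookup A e ≡ true → c e < suc d ℕ.* k e
    c<Dk e inA = ℕP.*-monoˡ-< (k e)
      (subst (num e ℕ.* cofactor e <_) (trans (ℕP.*-comm (den e) (cofactor e)) (trans (sym (common≡ e)) (sym suc-d)))
        (ℕP.*-monoˡ-< (cofactor e) {{quotient≢0 (factor∣Πℕ den e)}}
          (numerator<denominator (lam e) (0≤lam e inA) (proj₂ (bounds e (VecP.lookup⇒[]= e A inA))))))
    regroup : ∀ a k R D → a * k * (R * D) ≡ (a * R * k) * D
    regroup = solve-∀
    term : ∀ e → lookup A e ≡ true → ∀ t → lam e ℚ.* ((+ k e * t) ℚ./ 1) ≡ (+ c e * t) ℚ./ suc d
    term e inA t = fraction-term (k e) (c e) t d (fraction-self (lam e)) (begin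
      ℚ.↥ (lam e) * + k e * + suc d                  ≡⟨ cong₂ (λ a D → a * + k e * + D) (numerator-nonNeg (lam e) (0≤lam e inA)) (trans suc-d (common≡ e)) ⟩
      + num e * + k e * + (cofactor e ℕ.* den e)     ≡⟨ cong (+ num e * + k e *_) (ℤP.pos-* (cofactor e) (den e)) ⟩
      + num e * + k e * (+ cofactor e * + den e)     ≡⟨ regroup (+ num e) (+ k e) (+ cofactor e) (+ den e) ⟩
      (+ num e * + cofactor e * + k e) * + den e     ≡⟨ cong (_* + den e) (sym (trans (ℤP.pos-* (num e ℕ.* cofactor e) (k e)) (cong (_* + k e) (ℤP.pos-* (num e) (cofactor e))))) ⟩
      + c e * + den e                                ∎)
      where open ≡-Reasoning

module PolynomialIdentity {c ℓ : Level} (R : CommutativeRing c ℓ) where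
  open CommutativeRing R hiding (zero) renaming (refl to ≈-refl; sym to ≈-sym; trans to ≈-trans; _*_ to _*ᴿ_; _-_ to _-ᴿ_)
  open RingOps R
  open import Relation.Binary.Reasoning.Setoid setoid
  open SemiringMult semiring using (×1-homo-*) renaming (_×_ to _×ₙ_)

  fromℕ≈×1 : ∀ a → fromℕ a ≈ a ×ₙ 1#
  fromℕ≈×1 zero    = ≈-refl
  fromℕ≈×1 (suc a) = +-congˡ (fromℕ≈×1 a)

  fromℕ-* : ∀ a b → fromℕ (a ℕ.* b) ≈ fromℕ a *ᴿ fromℕ b
  fromℕ-* a b = ≈-trans (fromℕ≈×1 (a ℕ.* b))
                      (≈-trans (×1-homo-* a b) (*-cong (≈-sym (fromℕ≈×1 a)) (≈-sym (fromℕ≈×1 b))))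

  fromℕ-Πℕ : ∀ {m} (f : Fin m → ℕ) → fromℕ (Πℕ f) ≈ ΠFin (λ e → fromℕ (f e))
  fromℕ-Πℕ {zero}  f = +-identityʳ 1#
  fromℕ-Πℕ {suc m} f = ≈-trans (fromℕ-* (f zero) _) (*-congˡ (fromℕ-Πℕ (λ e → f (suc e))))

  ΠFin-cong : ∀ {m} {f g : Fin m → Carrier} → (∀ e → f e ≈ g e) → ΠFin f ≈ ΠFin g
  ΠFin-cong {zero}  f≈g = ≈-refl
  ΠFin-cong {suc m} f≈g = *-cong (f≈g zero) (ΠFin-cong (λ e → f≈g (suc e)))

  ΠFin-* : ∀ {m} (f g : Fin m → Carrier) → ΠFin f *ᴿ ΠFin g ≈ ΠFin (λ e → f e *ᴿ g e)
  ΠFin-* {zero}  f g = *-identityˡ 1#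
  ΠFin-* {suc m} f g = ≈-trans (interchange (f zero) _ (g zero) _) (*-congˡ (ΠFin-* (λ e → f (suc e)) (λ e → g (suc e))))
    where open import Algebra.Properties.CommutativeSemigroup *-commutativeSemigroup using (interchange)

  ΣSub-cong : ∀ {m} (f g : Subset m → Carrier) → (∀ A → f A ≈ g A) → ΣSub f ≈ ΣSub g
  ΣSub-cong {zero}  f g f≈g = f≈g []
  ΣSub-cong {suc m} f g f≈g = +-cong (ΣSub-cong _ _ (λ A → f≈g (true ∷ A))) (ΣSub-cong _ _ (λ A → f≈g (false ∷ A)))

  expectation-identity : ∀ {m} (k : Fin m → ℕ) (p : Fin m → Carrier) (N mult : Subset m → ℕ) →
                         (∀ A → N A ≡ Πℕ (λ e → if lookup A e then k e else 1) ℕ.* mult A) →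
                         Expect p N ≈ RHS k p mult
  expectation-identity {m} k p N mult N≡ = ΣSub-cong _ _ termwise
    where
    termwise : ∀ A → Prob p A *ᴿ fromℕ (N A) ≈
                     fromℕ (mult A) *ᴿ ΠFin (λ e → if lookup A e then fromℕ (k e) *ᴿ p e else (1# -ᴿ p e))
    termwise A = begin
      Prob p A *ᴿ fromℕ (N A)                                    ≈⟨ *-congˡ (reflexive (cong fromℕ (N≡ A))) ⟩
      Prob p A *ᴿ fromℕ (Πℕ scale ℕ.* mult A)                    ≈⟨ *-congˡ (fromℕ-* (Πℕ scale) (mult A)) ⟩
      Prob p A *ᴿ (fromℕ (Πℕ scale) *ᴿ fromℕ (mult A))            ≈⟨ ≈-trans (≈-sym (*-assoc _ _ _)) (*-comm _ _) ⟩
      fromℕ (mult A) *ᴿ (Prob p A *ᴿ fromℕ (Πℕ scale))            ≈⟨ *-congˡ (*-congˡ (fromℕ-Πℕ scale)) ⟩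
      fromℕ (mult A) *ᴿ (Prob p A *ᴿ ΠFin (λ e → fromℕ (scale e))) ≈⟨ *-congˡ (ΠFin-* {m} _ _) ⟩
      fromℕ (mult A) *ᴿ ΠFin (λ e → (if lookup A e then p e else (1# -ᴿ p e)) *ᴿ fromℕ (scale e))
                                                                ≈⟨ *-congˡ (ΠFin-cong (λ e → factor e (lookup A e))) ⟩
      fromℕ (mult A) *ᴿ ΠFin (λ e → if lookup A e then fromℕ (k e) *ᴿ p e else (1# -ᴿ p e)) ∎
      where
      scale : Fin m → ℕ
      scale e = if lookup A e then k e else 1
      factor : ∀ e b → (if b then p e else (1# -ᴿ p e)) *ᴿ fromℕ (if b then k e else 1) ≈
                       (if b then fromℕ (k e) *ᴿ p e else (1# -ᴿ p e))
      factor e true  = *-comm _ _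
      factor e false = ≈-trans (*-congˡ (+-identityʳ 1#)) (*-identityʳ _)

theorem3p7 : ∀ {c ℓ : Level} (m n : ℕ) (E : Fin m → Point n) → LinIndep E →
    (k : Fin m → ℕ) → (∀ e → 0 < k e) →
    ∃ λ (N : Subset m → ℕ) → ∃ λ (mult : Subset m → ℕ) →
      (∀ A → ZonoCard E k A (N A)) × (∀ A → TorsionCard E A (mult A)) ×
      ((R : CommutativeRing c ℓ) → (p : Fin m → CommutativeRing.Carrier R) →
        CommutativeRing._≈_ R (RingOps.Expect R p N) (RingOps.RHS R k p mult))
theorem3p7 m n E indep k k>0 = N , mult , zonoCard , torsionCard ,
  λ R p → PolynomialIdentity.expectation-identity R k p N mult (λ A → ZonoPoints.length-zonoPoints E indep A k)
  where
  N mult : Subset m → ℕ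
  N A = length (ZonoPoints.zonoPoints E indep A k)
  mult A = length (ParaPoints.paraPoints E indep A)
  zonoCard : ∀ A → ZonoCard E k A (N A)
  zonoCard A = zonoPoints , refl , zonoPoints-unique ,
               λ x → mk⇔ (λ x∈ → zono⇒zonotope E A k k>0 (∈zonoPoints⁻ x∈)) (λ x∈ → ∈zonoPoints⁺ (zonotope⇒zono E A k k>0 x∈))
    where open ZonoPoints E indep A k
  torsionCard : ∀ A → TorsionCard E A (mult A)
  torsionCard A = TorsionPoints.paraPoints-torsionCard E indep A
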